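{- Let $M=(E,\mathcal{I})$ be a matroid of rank $r=r(E)\ge1$, let $x^*$ be the point of minimum Euclidean norm in the base polytope $P_B$ of $M$, and let $x^1,x^2,\ldots$ be the relative loads of a greedy base packing of $M$. Then for every $k\ge1$, $$\|x^k-x^*\|_2\le\sqrt{2r\frac{\log(k+1)}{k}}.$$
   Context: $P_B$ is the convex hull of the indicator vectors $\xi_B\in\{0,1\}^E$ of bases $B$ of $M$. A greedy base packing is a sequence of bases $B_1,B_2,\ldots$ with $B_k$ a minimum-weight base with respect to weights $x^{k-1}$ (ties arbitrary), where $x^0=\mathbf 0$ and $x^k=\frac1k(\xi_{B_1}+\cdots+\xi_{B_k})$. $\log$ is the natural logarithm. -}

module Defs where

open import Data.Nat as ℕ using (ℕ; zero; suc; _^_)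
open import Data.Integer using (+_)
open import Data.Rational using (ℚ; 0ℚ; 1ℚ; _+_; _*_; _-_; _/_; _≤_)
open import Data.Bool using (Bool; true; false)
open import Data.Fin using (Fin)
import Data.Fin as F
open import Data.Fin.Subset using (Subset; ⊥; ⁅_⁆; _∈_; _∉_; _⊆_; _∪_; ∣_∣)
open import Data.Vec using (lookup)
open import Data.List using (List; map)
open import Data.List.Relation.Unary.All using (All)
open import Data.Product using (Σ; ∃; _×_; _,_; proj₁; proj₂)
open import Data.Sum using (_⊎_)
open import Relation.Binary.PropositionalEquality using (_≡_)

record Matroid (n : ℕ) : Set₁ where
  field
    Indep      : Subset n → Set
    indep-∅    : Indep ⊥
    indep-⊆    : ∀ {A B} → B ⊆ A → Indep A → Indep B
    indep-aug  : ∀ {A B} → Indep A → Indep B → ∣ A ∣ ℕ.< ∣ B ∣ →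
                 ∃ λ e → e ∈ B × e ∉ A × Indep (A ∪ ⁅ e ⁆)

open Matroid public

IsBase : ∀ {n} → Matroid n → Subset n → Set
IsBase M B = Indep M B × (∀ S → Indep M S → B ⊆ S → S ≡ B)

-- r(E) = r : some (hence every) base has r elements
HasRank : ∀ {n} → Matroid n → ℕ → Set
HasRank M r = ∃ λ B → IsBase M B × ∣ B ∣ ≡ r

sumFin : ∀ {n} → (Fin n → ℚ) → ℚ
sumFin {zero}  f = 0ℚ
sumFin {suc n} f = f F.zero + sumFin (λ i → f (F.suc i))

ξ : ∀ {n} → Subset n → Fin n → ℚ
ξ B e with lookup B e
... | true  = 1ℚ
... | false = 0ℚ

normSq : ∀ {n} → (Fin n → ℚ) → ℚ
normSq v = sumFin (λ e → v e * v e)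

sumL : List ℚ → ℚ
sumL = Data.List.foldr _+_ 0ℚ
  where import Data.List

-- (rational) points of the base polytope P_B: convex combinations of
-- indicator vectors of bases
InBasePolytope : ∀ {n} → Matroid n → (Fin n → ℚ) → Set
InBasePolytope {n} M y =
  Σ (List (Subset n × ℚ)) λ cs →
    All (λ c → IsBase M (proj₁ c) × 0ℚ ≤ proj₂ c) cs
    × sumL (map proj₂ cs) ≡ 1ℚ
    × (∀ e → y e ≡ sumL (map (λ c → proj₂ c * ξ (proj₁ c) e) cs))

IsMinNormPoint : ∀ {n} → Matroid n → (Fin n → ℚ) → Set
IsMinNormPoint M x* = InBasePolytope M x* × (∀ y → InBasePolytope M y → normSq x* ≤ normSq y)

-- load count: number of i ∈ {1..k} with e ∈ B_i  (B i = B_i; B 0 unused)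
count : ∀ {n} → (ℕ → Subset n) → ℕ → Fin n → ℕ
count B zero    e = 0
count B (suc k) e with lookup (B (suc k)) e
... | true  = suc (count B k e)
... | false = count B k e

load : ∀ {n} → (ℕ → Subset n) → ℕ → Fin n → ℚ
load B zero    e = 0ℚ
load B (suc k) e = (+ count B (suc k) e) / suc k

weight : ∀ {n} → (Fin n → ℚ) → Subset n → ℚ
weight w S = sumFin (λ e → w e * ξ S e)

-- B_1, B_2, ... is a greedy base packing: B_k is a minimum-weight base
-- w.r.t. x^{k-1} (ties arbitrary).
IsGreedyBasePacking : ∀ {n} → Matroid n → (ℕ → Subset n) → Set
IsGreedyBasePacking M B = ∀ k →
  IsBase M (B (suc k)) ×
  (∀ B' → IsBase M B' → weight (load B k) (B (suc k)) ≤ weight (load B k) B')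

expTerm : ℚ → ℕ → ℚ
expTerm a zero    = 1ℚ
expTerm a (suc i) = expTerm a i * a * ((+ 1) / suc i)

expPartial : ℚ → ℕ → ℚ
expPartial a zero    = 1ℚ
expPartial a (suc N) = expPartial a N + expTerm a (suc N)

-- "a ≤ c · log m" (natural log, m ≥ 1), stated without reals:
-- for a ≤ 0 it holds trivially; for a ≥ 0 it is equivalent to
-- exp a ≤ m^c, i.e. every partial sum of the exponential series of a is ≤ m^c.
_≤_·log_ : ℚ → ℕ → ℕ → Set
a ≤ c ·log m = a ≤ 0ℚ ⊎ (∀ N → expPartial a N ≤ (+ (m ^ c)) / 1)

{-# OPTIONS --safe #-}
module Submission where

-- Let Sₖ = ξ_{B₁} + ⋯ + ξ_{Bₖ} = k·xᵏ and vₖ = Sₖ − k·x*, so that v_{k+1} = vₖ + (ξ_{B_{k+1}} − x*).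
-- The cross term ⟨vₖ, ξ_{B_{k+1}} − x*⟩ is ≤ 0: greedy minimality gives ⟨Sₖ, ξ_{B_{k+1}}⟩ ≤ ⟨Sₖ, x*⟩
-- (a linear function is minimised over P_B at a base), and first-order optimality of x* over P_B
-- gives ⟨x*, ξ_B − x*⟩ ≥ 0 for every base B. The latter also yields ‖ξ_B − x*‖² ≤ ‖ξ_B‖² = |B| ≤ r.
-- Hence ‖vₖ‖² ≤ k·r, i.e. k‖xᵏ − x*‖² ≤ r ≤ 2r·log 2. In exponential form this last step is
-- e^r ≤ 4^r on partial sums, obtained by comparing rⁱ/i! termwise with the coefficients
-- C(2r+i−1, i)/2ⁱ of (1 − ½)^(−2r).

module GreedyBasePacking where

  open import Level using (0ℓ)
  open import Function using (_∘_)
  open import Data.Bool using (true; false)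
  open import Data.Empty using (⊥-elim)
  open import Data.Nat as ℕ using (ℕ; zero; suc; z≤n; s≤s)
  import Data.Nat.Properties as ℕ
  open import Data.Nat.Tactic.RingSolver as ℕ-Solver using ()
  open import Data.Integer as ℤ using ()
  import Data.Integer.Properties as ℤ
  open import Data.Rational
    using ( ℚ; 0ℚ; 1ℚ; ½; _+_; _*_; _-_; -_; _/_; 1/_; _≤_; _<_; _≟_; fromℚᵘ
          ; Positive; NonZero; positive; nonNegative)
  open import Data.Rational.Properties
  import Data.Rational.Unnormalised as ℚᵘ
  import Data.Rational.Unnormalised.Properties as ℚᵘ
  open import Data.Fin using (Fin; zero; suc)
  open import Data.Fin.Subset using (Subset; ∣_∣; _∪_; ⁅_⁆; _∈_)
  open import Data.Fin.Subset.Properties using (p⊆p∪q; x∈p∪q⁺; x∈⁅x⁆)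
  open import Data.Vec using ([]; _∷_; lookup)
  open import Data.List using (List; []; _∷_; map)
  open import Data.List.Relation.Unary.All as All using (All; []; _∷_)
  import Data.List.Relation.Unary.All.Properties as All
  open import Data.Product using (_×_; _,_; proj₁; proj₂; map₂)
  open import Data.Sum using (inj₁; inj₂)
  open import Relation.Binary.PropositionalEquality
  open import Relation.Nullary using (yes; no)
  open import Relation.Nullary.Decidable.Core using (dec⇒maybe)
  open import Algebra.Bundles using (Ring)
  open import Algebra.Properties.Semiring.Sum (Ring.semiring +-*-ring)
    using (sum; ∑-distrib-+; sum-cong-≗; sum-replicate-zero; *-distribˡ-sum)
  open import Algebra.Definitions.RawSemiring +-*-rawSemiring using (_^_)
  open import Tactic.RingSolver using (solve-∀)
  open import Tactic.RingSolver.Core.AlmostCommutativeRing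
    using (AlmostCommutativeRing; fromCommutativeRing)
  open import Defs

  variable
    n : ℕ

  ℚ-ring : AlmostCommutativeRing 0ℓ 0ℓ
  ℚ-ring = fromCommutativeRing +-*-commutativeRing (λ x → dec⇒maybe (0ℚ ≟ x))

  ι : ℕ → ℚ
  ι n = ℤ.+ n / 1

  ιᵘ : ℕ → ℚᵘ.ℚᵘ
  ιᵘ n = ℚᵘ.mkℚᵘ (ℤ.+ n) 0

  fromℚᵘ-homo-+ : ∀ p q → fromℚᵘ (p ℚᵘ.+ q) ≡ fromℚᵘ p + fromℚᵘ q
  fromℚᵘ-homo-+ p q = toℚᵘ-injective (ℚᵘ.≃-trans (toℚᵘ-fromℚᵘ (p ℚᵘ.+ q))
    (ℚᵘ.≃-sym (ℚᵘ.≃-trans (toℚᵘ-homo-+ (fromℚᵘ p) (fromℚᵘ q))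
                           (ℚᵘ.+-cong (toℚᵘ-fromℚᵘ p) (toℚᵘ-fromℚᵘ q)))))

  fromℚᵘ-homo-* : ∀ p q → fromℚᵘ (p ℚᵘ.* q) ≡ fromℚᵘ p * fromℚᵘ q
  fromℚᵘ-homo-* p q = toℚᵘ-injective (ℚᵘ.≃-trans (toℚᵘ-fromℚᵘ (p ℚᵘ.* q))
    (ℚᵘ.≃-sym (ℚᵘ.≃-trans (toℚᵘ-homo-* (fromℚᵘ p) (fromℚᵘ q))
                           (ℚᵘ.*-cong (toℚᵘ-fromℚᵘ p) (toℚᵘ-fromℚᵘ q)))))

  ι-homo-+ : ∀ m n → ι (m ℕ.+ n) ≡ ι m + ι n
  ι-homo-+ m n = trans (fromℚᵘ-cong {ιᵘ (m ℕ.+ n)} {ιᵘ m ℚᵘ.+ ιᵘ n} (ℚᵘ.*≡* (cong (ℤ._* ℤ.+ 1)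
      (trans (ℤ.pos-+ m n) (sym (cong₂ ℤ._+_ (ℤ.*-identityʳ (ℤ.+ m)) (ℤ.*-identityʳ (ℤ.+ n))))))))
    (fromℚᵘ-homo-+ (ιᵘ m) (ιᵘ n))

  ι-homo-* : ∀ m n → ι (m ℕ.* n) ≡ ι m * ι n
  ι-homo-* m n = trans (fromℚᵘ-cong {ιᵘ (m ℕ.* n)} {ιᵘ m ℚᵘ.* ιᵘ n} (ℚᵘ.*≡* (cong (ℤ._* ℤ.+ 1) (ℤ.pos-* m n))))
    (fromℚᵘ-homo-* (ιᵘ m) (ιᵘ n))

  ι[1+k]*[c/1+k]≡ι[c] : ∀ k c → ι (suc k) * (ℤ.+ c / suc k) ≡ ι c
  ι[1+k]*[c/1+k]≡ι[c] k c = trans (sym (fromℚᵘ-homo-* (ιᵘ (suc k)) (ℚᵘ.mkℚᵘ (ℤ.+ c) k)))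
    (fromℚᵘ-cong {ιᵘ (suc k) ℚᵘ.* ℚᵘ.mkℚᵘ (ℤ.+ c) k} {ιᵘ c} (ℚᵘ.*≡* (trans (ℤ.*-identityʳ _)
      (trans (ℤ.*-comm (ℤ.+ suc k) (ℤ.+ c)) (cong (λ d → ℤ.+ c ℤ.* ℤ.+ suc d) (sym (ℕ.+-identityʳ k)))))))

  0≤ι : ∀ n → 0ℚ ≤ ι n
  0≤ι n = nonNegative⁻¹ (ι n) {{normalize-nonNeg n 1}}

  ι-mono-≤ : ∀ {m n} → m ℕ.≤ n → ι m ≤ ι n
  ι-mono-≤ {m} {n} m≤n = begin
    ι m                 ≡⟨ +-identityʳ (ι m) ⟨
    ι m + 0ℚ            ≤⟨ +-monoʳ-≤ (ι m) (0≤ι (n ℕ.∸ m)) ⟩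
    ι m + ι (n ℕ.∸ m)   ≡⟨ ι-homo-+ m (n ℕ.∸ m) ⟨
    ι (m ℕ.+ (n ℕ.∸ m)) ≡⟨ cong ι (ℕ.m+[n∸m]≡n m≤n) ⟩
    ι n                 ∎
    where open ≤-Reasoning

  0<ι[1+n] : ∀ n → 0ℚ < ι (suc n)
  0<ι[1+n] n = positive⁻¹ (ι (suc n)) {{normalize-pos (suc n) 1}}

  *-nonNeg : ∀ {p q} → 0ℚ ≤ p → 0ℚ ≤ q → 0ℚ ≤ p * q
  *-nonNeg {p} {q} 0≤p 0≤q =
    nonNegative⁻¹ (p * q) {{nonNeg*nonNeg⇒nonNeg p {{nonNegative 0≤p}} q {{nonNegative 0≤q}}}}

  *-monoˡ-≤-0≤ : ∀ {r p q} → 0ℚ ≤ r → p ≤ q → r * p ≤ r * q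
  *-monoˡ-≤-0≤ {r} 0≤r = *-monoˡ-≤-nonNeg r {{nonNegative 0≤r}}

  *-self-nonNeg : ∀ p → 0ℚ ≤ p * p
  *-self-nonNeg p with ≤-total 0ℚ p
  ... | inj₁ 0≤p = *-nonNeg 0≤p 0≤p
  ... | inj₂ p≤0 = subst (0ℚ ≤_) (neg*neg p) (*-nonNeg (neg-antimono-≤ p≤0) (neg-antimono-≤ p≤0))
    where
    neg*neg : ∀ p → - p * - p ≡ p * p
    neg*neg = solve-∀ ℚ-ring

  p≤q⇒p-q≤0 : ∀ {p q} → p ≤ q → p - q ≤ 0ℚ
  p≤q⇒p-q≤0 {p} {q} p≤q = subst (p - q ≤_) (+-inverseʳ q) (+-monoˡ-≤ (- q) p≤q)

  p≤q⇒0≤q-p : ∀ {p q} → p ≤ q → 0ℚ ≤ q - p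
  p≤q⇒0≤q-p {p} {q} p≤q = subst (_≤ q - p) (+-inverseʳ p) (+-monoˡ-≤ (- p) p≤q)

  infixl 6 _+ᵥ_ _-ᵥ_
  infixr 7 _*ᵥ_

  _+ᵥ_ _-ᵥ_ : (u v : Fin n → ℚ) → Fin n → ℚ
  (u +ᵥ v) e = u e + v e
  (u -ᵥ v) e = u e - v e

  _*ᵥ_ : ℚ → (Fin n → ℚ) → Fin n → ℚ
  (c *ᵥ v) e = c * v e

  dot : (u v : Fin n → ℚ) → ℚ
  dot u v = sum (λ e → u e * v e)

  sumFin≡sum : (f : Fin n → ℚ) → sumFin f ≡ sum f
  sumFin≡sum {zero}  f = refl
  sumFin≡sum {suc n} f = cong (f zero +_) (sumFin≡sum (f ∘ suc))

  normSq≡dot : (v : Fin n → ℚ) → normSq v ≡ dot v v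
  normSq≡dot v = sumFin≡sum (λ e → v e * v e)

  weight≡dot : (w : Fin n → ℚ) (S : Subset n) → weight w S ≡ dot w (ξ S)
  weight≡dot w S = sumFin≡sum (λ e → w e * ξ S e)

  sum-neg : (f : Fin n → ℚ) → sum (λ e → - f e) ≡ - sum f
  sum-neg {zero}  f = refl
  sum-neg {suc n} f = trans (cong (- f zero +_) (sum-neg (f ∘ suc)))
                            (sym (neg-distrib-+ (f zero) (sum (f ∘ suc))))

  sum-nonNeg : {f : Fin n → ℚ} → (∀ e → 0ℚ ≤ f e) → 0ℚ ≤ sum f
  sum-nonNeg {zero}  0≤f = ≤-refl
  sum-nonNeg {suc n} 0≤f = +-mono-≤ (0≤f zero) (sum-nonNeg (0≤f ∘ suc))

  dot-cong : ∀ {u u′ v v′ : Fin n → ℚ} → (∀ e → u e ≡ u′ e) → (∀ e → v e ≡ v′ e) → dot u v ≡ dot u′ v′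
  dot-cong u≗u′ v≗v′ = sum-cong-≗ (λ e → cong₂ _*_ (u≗u′ e) (v≗v′ e))

  dot-self-nonNeg : (u : Fin n → ℚ) → 0ℚ ≤ dot u u
  dot-self-nonNeg u = sum-nonNeg (λ e → *-self-nonNeg (u e))

  dot-zeroʳ : (u : Fin n → ℚ) → dot u (λ _ → 0ℚ) ≡ 0ℚ
  dot-zeroʳ {n} u = trans (sum-cong-≗ (λ e → *-zeroʳ (u e))) (sum-replicate-zero n)

  dot-distribʳ-+ : (u v w : Fin n → ℚ) → dot u (v +ᵥ w) ≡ dot u v + dot u w
  dot-distribʳ-+ u v w = trans (sum-cong-≗ (λ e → *-distribˡ-+ (u e) (v e) (w e)))
    (∑-distrib-+ (λ e → u e * v e) (λ e → u e * w e))

  dot-distribʳ-- : (u v w : Fin n → ℚ) → dot u (v -ᵥ w) ≡ dot u v - dot u w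
  dot-distribʳ-- u v w = begin
    dot u (v -ᵥ w)                        ≡⟨ sum-cong-≗ (λ e → trans (*-distribˡ-+ (u e) (v e) (- w e))
                                               (cong (u e * v e +_) (sym (neg-distribʳ-* (u e) (w e))))) ⟩
    sum (λ e → u e * v e + - (u e * w e)) ≡⟨ ∑-distrib-+ (λ e → u e * v e) (λ e → - (u e * w e)) ⟩
    dot u v + sum (λ e → - (u e * w e))   ≡⟨ cong (dot u v +_) (sum-neg (λ e → u e * w e)) ⟩
    dot u v - dot u w                     ∎
    where open ≡-Reasoning

  dot-distribˡ-- : (u v w : Fin n → ℚ) → dot (u -ᵥ v) w ≡ dot u w - dot v w
  dot-distribˡ-- u v w = begin
    dot (u -ᵥ v) w                        ≡⟨ sum-cong-≗ (λ e → trans (*-distribʳ-+ (w e) (u e) (- v e))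
                                               (cong (u e * w e +_) (sym (neg-distribˡ-* (v e) (w e))))) ⟩
    sum (λ e → u e * w e + - (v e * w e)) ≡⟨ ∑-distrib-+ (λ e → u e * w e) (λ e → - (v e * w e)) ⟩
    dot u w + sum (λ e → - (v e * w e))   ≡⟨ cong (dot u w +_) (sum-neg (λ e → v e * w e)) ⟩
    dot u w - dot v w                     ∎
    where open ≡-Reasoning

  dot-*ʳ : (c : ℚ) (u v : Fin n → ℚ) → dot u (c *ᵥ v) ≡ c * dot u v
  dot-*ʳ c u v = trans (sum-cong-≗ (λ e → x*[c*y]≡c*[x*y] (u e) c (v e)))
                       (sym (*-distribˡ-sum c (λ e → u e * v e)))
    where
    x*[c*y]≡c*[x*y] : ∀ x c y → x * (c * y) ≡ c * (x * y)
    x*[c*y]≡c*[x*y] = solve-∀ ℚ-ring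

  dot-*ˡ : (c : ℚ) (u v : Fin n → ℚ) → dot (c *ᵥ u) v ≡ c * dot u v
  dot-*ˡ c u v = trans (sum-cong-≗ (λ e → *-assoc c (u e) (v e))) (sym (*-distribˡ-sum c (λ e → u e * v e)))

  dot-self-+ : (u w : Fin n → ℚ) → dot (u +ᵥ w) (u +ᵥ w) ≡ dot u u + ((dot u w + dot u w) + dot w w)
  dot-self-+ u w = begin
    dot (u +ᵥ w) (u +ᵥ w)                                         ≡⟨ sum-cong-≗ (λ e → expand (u e) (w e)) ⟩
    sum (λ e → u e * u e + ((u e * w e + u e * w e) + w e * w e))
      ≡⟨ ∑-distrib-+ (λ e → u e * u e) (λ e → (u e * w e + u e * w e) + w e * w e) ⟩
    dot u u + sum (λ e → (u e * w e + u e * w e) + w e * w e)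
      ≡⟨ cong (dot u u +_) (∑-distrib-+ (λ e → u e * w e + u e * w e) (λ e → w e * w e)) ⟩
    dot u u + (sum (λ e → u e * w e + u e * w e) + dot w w)
      ≡⟨ cong (λ z → dot u u + (z + dot w w)) (∑-distrib-+ (λ e → u e * w e) (λ e → u e * w e)) ⟩
    dot u u + ((dot u w + dot u w) + dot w w)                     ∎
    where
    open ≡-Reasoning
    expand : ∀ x y → (x + y) * (x + y) ≡ x * x + ((x * y + x * y) + y * y)
    expand = solve-∀ ℚ-ring

  ξ-idem : (S : Subset n) (e : Fin n) → ξ S e * ξ S e ≡ ξ S e
  ξ-idem S e with lookup S e
  ... | true  = refl
  ... | false = refl

  sum-ξ : (S : Subset n) → sum (ξ S) ≡ ι ∣ S ∣
  sum-ξ []          = refl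
  sum-ξ (true ∷ S)  = trans (cong (1ℚ +_) (sum-ξ S)) (sym (ι-homo-+ 1 ∣ S ∣))
  sum-ξ (false ∷ S) = trans (+-identityˡ (sum (ξ S))) (sum-ξ S)

  dot-ξ-ξ : (S : Subset n) → dot (ξ S) (ξ S) ≡ ι ∣ S ∣
  dot-ξ-ξ S = trans (sum-cong-≗ (ξ-idem S)) (sum-ξ S)

  indep-size≤base-size : (M : Matroid n) {B S : Subset n} → IsBase M B → Indep M S → ∣ S ∣ ℕ.≤ ∣ B ∣
  indep-size≤base-size M {B} (indB , maxB) indS = ℕ.≮⇒≥ λ ∣B∣<∣S∣ →
    let (e , _ , e∉B , indB∪e) = indep-aug M indB indS ∣B∣<∣S∣
    in e∉B (subst (e ∈_) (maxB (B ∪ ⁅ e ⁆) indB∪e (p⊆p∪q ⁅ e ⁆)) (x∈p∪q⁺ (inj₂ (x∈⁅x⁆ e))))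

  base-size≤rank : (M : Matroid n) {r : ℕ} {S : Subset n} → HasRank M r → IsBase M S → ∣ S ∣ ℕ.≤ r
  base-size≤rank M {S = S} (B₀ , isB₀ , ∣B₀∣≡r) (indS , _) =
    subst (∣ S ∣ ℕ.≤_) ∣B₀∣≡r (indep-size≤base-size M isB₀ indS)

  totalWeight : List (Subset n × ℚ) → ℚ
  totalWeight cs = sumL (map proj₂ cs)

  combination : List (Subset n × ℚ) → Fin n → ℚ
  combination cs e = sumL (map (λ c → proj₂ c * ξ (proj₁ c) e) cs)

  scale : ℚ → List (Subset n × ℚ) → List (Subset n × ℚ)
  scale s = map (map₂ (s *_))

  totalWeight-scale : (s : ℚ) (cs : List (Subset n × ℚ)) → totalWeight (scale s cs) ≡ s * totalWeight cs
  totalWeight-scale s []             = sym (*-zeroʳ s)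
  totalWeight-scale s ((_ , l) ∷ cs) =
    trans (cong (s * l +_) (totalWeight-scale s cs)) (sym (*-distribˡ-+ s l (totalWeight cs)))

  combination-scale : (s : ℚ) (cs : List (Subset n × ℚ)) (e : Fin n) →
                      combination (scale s cs) e ≡ s * combination cs e
  combination-scale s []             e = sym (*-zeroʳ s)
  combination-scale s ((S , l) ∷ cs) e = trans (cong₂ _+_ (*-assoc s l (ξ S e)) (combination-scale s cs e))
                                               (sym (*-distribˡ-+ s (l * ξ S e) (combination cs e)))

  dot-combination : (f : Fin n → ℚ) (cs : List (Subset n × ℚ)) →
                    dot f (combination cs) ≡ sumL (map (λ c → proj₂ c * dot f (ξ (proj₁ c))) cs)
  dot-combination f []             = dot-zeroʳ f
  dot-combination f ((S , l) ∷ cs) = begin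
    dot f (l *ᵥ ξ S +ᵥ combination cs)          ≡⟨ dot-distribʳ-+ f (l *ᵥ ξ S) (combination cs) ⟩
    dot f (l *ᵥ ξ S) + dot f (combination cs)   ≡⟨ cong₂ _+_ (dot-*ʳ l f (ξ S)) (dot-combination f cs) ⟩
    l * dot f (ξ S) + sumL (map (λ c → proj₂ c * dot f (ξ (proj₁ c))) cs) ∎
    where open ≡-Reasoning

  lowerBound-weightedSum : {A : Set} {m : ℚ} (g : A → ℚ) (cs : List (A × ℚ)) →
    All (λ c → 0ℚ ≤ proj₂ c × m ≤ g (proj₁ c)) cs →
    m * sumL (map proj₂ cs) ≤ sumL (map (λ c → proj₂ c * g (proj₁ c)) cs)
  lowerBound-weightedSum {m = m} g [] [] = ≤-reflexive (*-zeroʳ m)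
  lowerBound-weightedSum {m = m} g ((a , l) ∷ cs) ((0≤l , m≤ga) ∷ bounds) = begin
    m * (l + sumL (map proj₂ cs))           ≡⟨ *-distribˡ-+ m l _ ⟩
    m * l + m * sumL (map proj₂ cs)         ≤⟨ +-mono-≤ (subst (_≤ l * g a) (*-comm l m) (*-monoˡ-≤-0≤ 0≤l m≤ga))
                                                        (lowerBound-weightedSum g cs bounds) ⟩
    l * g a + sumL (map (λ c → proj₂ c * g (proj₁ c)) cs) ∎
    where open ≤-Reasoning

  ≤-bases⇒≤-basePolytope : (M : Matroid n) (f : Fin n → ℚ) {m : ℚ} →
    (∀ S → IsBase M S → m ≤ dot f (ξ S)) → ∀ {y} → InBasePolytope M y → m ≤ dot f y
  ≤-bases⇒≤-basePolytope M f {m} bound {y} (cs , bases , total≡1 , y≗combination) = begin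
    m                                                  ≡⟨ trans (cong (m *_) total≡1) (*-identityʳ m) ⟨
    m * totalWeight cs                                 ≤⟨ lowerBound-weightedSum _ cs
                                                            (All.map (λ (isB , 0≤l) → 0≤l , bound _ isB) bases) ⟩
    sumL (map (λ c → proj₂ c * dot f (ξ (proj₁ c))) cs) ≡⟨ dot-combination f cs ⟨
    dot f (combination cs)                             ≡⟨ dot-cong {u = f} (λ _ → refl) y≗combination ⟨
    dot f y                                            ∎
    where open ≤-Reasoning

  basePolytope-segment : (M : Matroid n) {y : Fin n → ℚ} {S : Subset n} {t : ℚ} →
    InBasePolytope M y → IsBase M S → 0ℚ ≤ t → t ≤ 1ℚ → InBasePolytope M (y +ᵥ t *ᵥ (ξ S -ᵥ y))
  basePolytope-segment M {y} {S} {t} (cs , bases , total≡1 , y≗combination) isS 0≤t t≤1 =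
    (S , t) ∷ scale (1ℚ - t) cs ,
    (isS , 0≤t) ∷ All.map⁺ (All.map (map₂ (*-nonNeg (p≤q⇒0≤q-p t≤1))) bases) ,
    trans (cong (t +_) (trans (totalWeight-scale (1ℚ - t) cs) (cong ((1ℚ - t) *_) total≡1))) (t+[1-t]*1≡1 t) ,
    pointwise
    where
    t+[1-t]*1≡1 : ∀ t → t + (1ℚ - t) * 1ℚ ≡ 1ℚ
    t+[1-t]*1≡1 = solve-∀ ℚ-ring
    segment : ∀ a t b → a + t * (b - a) ≡ t * b + (1ℚ - t) * a
    segment = solve-∀ ℚ-ring
    pointwise : ∀ e → y e + t * (ξ S e - y e) ≡ t * ξ S e + combination (scale (1ℚ - t) cs) e
    pointwise e = begin
      y e + t * (ξ S e - y e)                    ≡⟨ segment (y e) t (ξ S e) ⟩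
      t * ξ S e + (1ℚ - t) * y e                 ≡⟨ cong (λ z → t * ξ S e + (1ℚ - t) * z) (y≗combination e) ⟩
      t * ξ S e + (1ℚ - t) * combination cs e    ≡⟨ cong (t * ξ S e +_) (combination-scale (1ℚ - t) cs e) ⟨
      t * ξ S e + combination (scale (1ℚ - t) cs) e ∎
      where open ≡-Reasoning

  0≤t[2g+tP]⇒0≤g : ∀ {g P} → 0ℚ ≤ P →
    (∀ t → 0ℚ ≤ t → t ≤ 1ℚ → 0ℚ ≤ t * ((g + g) + t * P)) → 0ℚ ≤ g
  0≤t[2g+tP]⇒0≤g {g} {P} 0≤P perturb with 0ℚ ≤? g
  ... | yes 0≤g = 0≤g
  ... | no 0≰g = ⊥-elim (<-irrefl refl (begin-strict
    0ℚ                ≤⟨ 0≤2g+tP ⟩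
    (g + g) + t * P   ≤⟨ +-monoʳ-≤ (g + g) tP≤c ⟩
    (g + g) + c       ≡⟨ 2g-g≡g g ⟩
    g                 <⟨ g<0 ⟩
    0ℚ                ∎))
    where
    open ≤-Reasoning
    -- t = −g/(−g + P) lies in (0, 1] and makes t·P ≤ −g, so 2g + t·P ≤ g < 0.
    g<0 : g < 0ℚ
    g<0 = ≰⇒> 0≰g
    c u t : ℚ
    c = - g
    u = c + P
    0<c : 0ℚ < c
    0<c = neg-antimono-< g<0
    0<u : 0ℚ < u
    0<u = +-mono-<-≤ 0<c 0≤P
    instance
      u-pos : Positive u
      u-pos = positive 0<u
      u-nonZero : NonZero u
      u-nonZero = pos⇒nonZero u
    t = c * 1/ u
    t*u≡c : t * u ≡ c
    t*u≡c = trans (*-assoc c (1/ u) u) (trans (cong (c *_) (*-inverseˡ u)) (*-identityʳ c))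
    0<t : 0ℚ < t
    0<t = positive⁻¹ t {{pos*pos⇒pos c {{positive 0<c}} (1/ u) {{1/pos⇒pos u}}}}
    t≤1 : t ≤ 1ℚ
    t≤1 = *-cancelʳ-≤-pos u (subst₂ _≤_ (sym t*u≡c) (sym (*-identityˡ u))
            (subst (_≤ u) (+-identityʳ c) (+-monoʳ-≤ c 0≤P)))
    tP≤c : t * P ≤ c
    tP≤c = subst (t * P ≤_) t*u≡c (*-monoˡ-≤-0≤ (<⇒≤ 0<t)
             (subst (_≤ u) (+-identityˡ P) (+-monoˡ-≤ P (<⇒≤ 0<c))))
    0≤2g+tP : 0ℚ ≤ (g + g) + t * P
    0≤2g+tP = *-cancelˡ-≤-pos t {{positive 0<t}}
                (subst (_≤ t * ((g + g) + t * P)) (sym (*-zeroʳ t)) (perturb t (<⇒≤ 0<t) t≤1))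
    2g-g≡g : ∀ g → (g + g) + - g ≡ g
    2g-g≡g = solve-∀ ℚ-ring

  minNorm-firstOrder : (M : Matroid n) {y : Fin n → ℚ} {S : Subset n} →
    IsMinNormPoint M y → IsBase M S → 0ℚ ≤ dot y (ξ S -ᵥ y)
  minNorm-firstOrder M {y} {S} (y∈P , y-min) isS = 0≤t[2g+tP]⇒0≤g (dot-self-nonNeg d) perturb
    where
    d : Fin _ → ℚ
    d = ξ S -ᵥ y
    expand : ∀ t → dot (y +ᵥ t *ᵥ d) (y +ᵥ t *ᵥ d) ≡ dot y y + t * ((dot y d + dot y d) + t * dot d d)
    expand t = begin
      dot (y +ᵥ t *ᵥ d) (y +ᵥ t *ᵥ d)
        ≡⟨ dot-self-+ y (t *ᵥ d) ⟩
      dot y y + ((dot y (t *ᵥ d) + dot y (t *ᵥ d)) + dot (t *ᵥ d) (t *ᵥ d))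
        ≡⟨ cong₂ (λ a b → dot y y + ((a + a) + b))
                 (dot-*ʳ t y d) (trans (dot-*ˡ t d (t *ᵥ d)) (cong (t *_) (dot-*ʳ t d d))) ⟩
      dot y y + ((t * dot y d + t * dot y d) + t * (t * dot d d))
        ≡⟨ factor (dot y y) t (dot y d) (dot d d) ⟩
      dot y y + t * ((dot y d + dot y d) + t * dot d d) ∎
      where
      open ≡-Reasoning
      factor : ∀ a t g P → a + ((t * g + t * g) + t * (t * P)) ≡ a + t * ((g + g) + t * P)
      factor = solve-∀ ℚ-ring
    perturb : ∀ t → 0ℚ ≤ t → t ≤ 1ℚ → 0ℚ ≤ t * ((dot y d + dot y d) + t * dot d d)
    perturb t 0≤t t≤1 = subst (0ℚ ≤_) (a+x-a≡x (dot y y) _) (p≤q⇒0≤q-p (subst₂ _≤_ (normSq≡dot y)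
      (trans (normSq≡dot (y +ᵥ t *ᵥ d)) (expand t)) (y-min _ (basePolytope-segment M y∈P isS 0≤t t≤1))))
      where
      a+x-a≡x : ∀ a x → (a + x) - a ≡ x
      a+x-a≡x = solve-∀ ℚ-ring

  dot-self-sub≤ : (y z : Fin n → ℚ) → 0ℚ ≤ dot y (z -ᵥ y) → dot (z -ᵥ y) (z -ᵥ y) ≤ dot z z
  dot-self-sub≤ y z 0≤g = begin
    dot d d                                  ≡⟨ trans (+-identityˡ _) (+-identityˡ _) ⟨
    0ℚ + ((0ℚ + 0ℚ) + dot d d)               ≤⟨ +-mono-≤ (dot-self-nonNeg y)
                                                          (+-monoˡ-≤ (dot d d) (+-mono-≤ 0≤g 0≤g)) ⟩
    dot y y + ((dot y d + dot y d) + dot d d) ≡⟨ dot-self-+ y d ⟨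
    dot (y +ᵥ d) (y +ᵥ d)                    ≡⟨ dot-cong y+d≡z y+d≡z ⟩
    dot z z                                  ∎
    where
    open ≤-Reasoning
    d : Fin _ → ℚ
    d = z -ᵥ y
    a+[b-a]≡b : ∀ a b → a + (b - a) ≡ b
    a+[b-a]≡b = solve-∀ ℚ-ring
    y+d≡z : ∀ e → y e + d e ≡ z e
    y+d≡z e = a+[b-a]≡b (y e) (z e)

  module _ {n} (M : Matroid n) {r : ℕ} (rank : HasRank M r) {x* : Fin n → ℚ} (x*-min : IsMinNormPoint M x*)
           {B : ℕ → Subset n} (greedy : IsGreedyBasePacking M B) where

    cumulative : ℕ → Fin n → ℚ
    cumulative k e = ι (count B k e)

    deviation : ℕ → Fin n → ℚ
    deviation k = cumulative k -ᵥ ι k *ᵥ x*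

    direction : ℕ → Fin n → ℚ
    direction k = ξ (B (suc k)) -ᵥ x*

    cumulative-suc : ∀ k e → cumulative (suc k) e ≡ cumulative k e + ξ (B (suc k)) e
    cumulative-suc k e with lookup (B (suc k)) e
    ... | true  = trans (ι-homo-+ 1 (count B k e)) (+-comm 1ℚ (cumulative k e))
    ... | false = sym (+-identityʳ (cumulative k e))

    deviation-suc : ∀ k e → deviation (suc k) e ≡ deviation k e + direction k e
    deviation-suc k e = trans (cong₂ (λ a b → a - b * x* e) (cumulative-suc k e) (ι-homo-+ 1 k))
                              (regroup (cumulative k e) (ξ (B (suc k)) e) (ι k) (x* e))
      where
      regroup : ∀ s b k y → (s + b) - (1ℚ + k) * y ≡ (s - k * y) + (b - y)
      regroup = solve-∀ ℚ-ring

    ι*load≡cumulative : ∀ k e → ι k * load B k e ≡ cumulative k e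
    ι*load≡cumulative zero    e = refl
    ι*load≡cumulative (suc k) e = ι[1+k]*[c/1+k]≡ι[c] k (count B (suc k) e)

    greedy-cumulative : ∀ k {S} → IsBase M S → dot (cumulative k) (ξ (B (suc k))) ≤ dot (cumulative k) (ξ S)
    greedy-cumulative k {S} isS =
      subst₂ _≤_ (scaled (B (suc k))) (scaled S) (*-monoˡ-≤-0≤ (0≤ι k) (proj₂ (greedy k) S isS))
      where
      scaled : ∀ S → ι k * weight (load B k) S ≡ dot (cumulative k) (ξ S)
      scaled S = trans (cong (ι k *_) (weight≡dot (load B k) S))
                       (trans (sym (dot-*ˡ (ι k) (load B k) (ξ S))) (dot-cong (ι*load≡cumulative k) (λ _ → refl)))

    greedy-below-x* : ∀ k → dot (cumulative k) (ξ (B (suc k))) ≤ dot (cumulative k) x*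
    greedy-below-x* k = ≤-bases⇒≤-basePolytope M (cumulative k) (λ _ → greedy-cumulative k) (proj₁ x*-min)

    descent : ∀ k → dot (deviation k) (direction k) ≤ 0ℚ
    descent k = begin
      dot (deviation k) (direction k)
        ≡⟨ dot-distribˡ-- (cumulative k) (ι k *ᵥ x*) (direction k) ⟩
      dot (cumulative k) (direction k) - dot (ι k *ᵥ x*) (direction k)
        ≡⟨ cong₂ _-_ (dot-distribʳ-- (cumulative k) (ξ (B (suc k))) x*) (dot-*ˡ (ι k) x* (direction k)) ⟩
      (dot (cumulative k) (ξ (B (suc k))) - dot (cumulative k) x*) - ι k * dot x* (direction k)
        ≤⟨ +-mono-≤ (p≤q⇒p-q≤0 (greedy-below-x* k))
                    (neg-antimono-≤ (*-nonNeg (0≤ι k) (minNorm-firstOrder M x*-min (proj₁ (greedy k))))) ⟩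
      0ℚ ∎
      where open ≤-Reasoning

    direction-size : ∀ k → dot (direction k) (direction k) ≤ ι r
    direction-size k = begin
      dot (direction k) (direction k)        ≤⟨ dot-self-sub≤ x* (ξ (B (suc k)))
                                                                (minNorm-firstOrder M x*-min isB) ⟩
      dot (ξ (B (suc k))) (ξ (B (suc k)))    ≡⟨ dot-ξ-ξ (B (suc k)) ⟩
      ι ∣ B (suc k) ∣                        ≤⟨ ι-mono-≤ (base-size≤rank M rank isB) ⟩
      ι r                                    ∎
      where
      open ≤-Reasoning
      isB = proj₁ (greedy k)

    deviation-bound : ∀ k → dot (deviation k) (deviation k) ≤ ι k * ι r
    deviation-bound zero = ≤-reflexive (trans (dot-cong deviation₀≡0 deviation₀≡0)
                                              (trans (dot-zeroʳ {n} (λ _ → 0ℚ)) (sym (*-zeroˡ (ι r)))))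
      where
      deviation₀≡0 : ∀ e → deviation zero e ≡ 0ℚ
      deviation₀≡0 e = cong (_-_ 0ℚ) (*-zeroˡ (x* e))
    deviation-bound (suc k) = begin
      dot (deviation (suc k)) (deviation (suc k))
        ≡⟨ dot-cong (deviation-suc k) (deviation-suc k) ⟩
      dot (v +ᵥ d) (v +ᵥ d)
        ≡⟨ dot-self-+ v d ⟩
      dot v v + ((dot v d + dot v d) + dot d d)
        ≤⟨ +-mono-≤ (deviation-bound k) (+-mono-≤ (+-mono-≤ (descent k) (descent k)) (direction-size k)) ⟩
      ι k * ι r + (0ℚ + ι r)
        ≡⟨ trans (collect (ι k) (ι r)) (cong (_* ι r) (sym (ι-homo-+ 1 k))) ⟩
      ι (suc k) * ι r ∎
      where
      open ≤-Reasoning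
      v d : Fin n → ℚ
      v = deviation k
      d = direction k
      collect : ∀ k r → k * r + (0ℚ + r) ≡ (1ℚ + k) * r
      collect = solve-∀ ℚ-ring

    scaledError-nonNeg : ∀ k → 0ℚ ≤ ι k * normSq (load B k -ᵥ x*)
    scaledError-nonNeg k = *-nonNeg (0≤ι k)
      (subst (0ℚ ≤_) (sym (normSq≡dot (load B k -ᵥ x*))) (dot-self-nonNeg (load B k -ᵥ x*)))

    scaledError≤rank : ∀ k → ι (suc k) * normSq (load B (suc k) -ᵥ x*) ≤ ι r
    scaledError≤rank k = *-cancelˡ-≤-pos K {{positive (0<ι[1+n] k)}} (begin
      K * (K * normSq (load B (suc k) -ᵥ x*))   ≡⟨ cong (λ z → K * (K * z)) (normSq≡dot e) ⟩
      K * (K * dot e e)                          ≡⟨ cong (K *_) (dot-*ʳ K e e) ⟨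
      K * dot e (K *ᵥ e)                         ≡⟨ dot-*ˡ K e (K *ᵥ e) ⟨
      dot (K *ᵥ e) (K *ᵥ e)                      ≡⟨ dot-cong K*e≡deviation K*e≡deviation ⟩
      dot (deviation (suc k)) (deviation (suc k)) ≤⟨ deviation-bound (suc k) ⟩
      K * ι r                                    ∎)
      where
      open ≤-Reasoning
      K : ℚ
      K = ι (suc k)
      e : Fin n → ℚ
      e = load B (suc k) -ᵥ x*
      distrib : ∀ k l y → k * (l - y) ≡ k * l - k * y
      distrib = solve-∀ ℚ-ring
      K*e≡deviation : ∀ i → K * e i ≡ deviation (suc k) i
      K*e≡deviation i = trans (distrib K (load B (suc k) i) (x* i))
                              (cong (_- K * x* i) (ι*load≡cumulative (suc k) i))

  partialSum : (ℕ → ℚ) → ℕ → ℚ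
  partialSum f zero    = f zero
  partialSum f (suc N) = partialSum f N + f (suc N)

  partialSum-mono-≤ : ∀ {f g : ℕ → ℚ} → (∀ i → f i ≤ g i) → ∀ N → partialSum f N ≤ partialSum g N
  partialSum-mono-≤ f≤g zero    = f≤g zero
  partialSum-mono-≤ f≤g (suc N) = +-mono-≤ (partialSum-mono-≤ f≤g N) (f≤g (suc N))

  partialSum-shift : ∀ {f g h : ℕ → ℚ} c → f zero ≡ g zero → (∀ i → f (suc i) ≡ g (suc i) + c * h i) →
                     ∀ N → partialSum f (suc N) ≡ partialSum g (suc N) + c * partialSum h N
  partialSum-shift {f} {g} {h} c f₀≡g₀ f≡g+ch zero = trans (cong₂ _+_ f₀≡g₀ (f≡g+ch zero))
    (sym (+-assoc (g zero) (g 1) (c * h zero)))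
  partialSum-shift {f} {g} {h} c f₀≡g₀ f≡g+ch (suc N) = trans
    (cong₂ _+_ (partialSum-shift c f₀≡g₀ f≡g+ch N) (f≡g+ch (suc N)))
    (regroup (partialSum g (suc N)) c (partialSum h N) (g (suc (suc N))) (h (suc N)))
    where
    regroup : ∀ a c p b x → (a + c * p) + (b + c * x) ≡ (a + b) + c * (p + x)
    regroup = solve-∀ ℚ-ring

  expPartial≡partialSum : ∀ a N → expPartial a N ≡ partialSum (expTerm a) N
  expPartial≡partialSum a zero    = refl
  expPartial≡partialSum a (suc N) = cong (_+ expTerm a (suc N)) (expPartial≡partialSum a N)

  0≤1/[1+n] : ∀ n → 0ℚ ≤ ℤ.+ 1 / suc n
  0≤1/[1+n] n = nonNegative⁻¹ _ {{normalize-nonNeg 1 (suc n)}}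

  0≤½ : 0ℚ ≤ ½
  0≤½ = 0≤1/[1+n] 1

  expTerm-nonNeg : ∀ {a} → 0ℚ ≤ a → ∀ i → 0ℚ ≤ expTerm a i
  expTerm-nonNeg 0≤a zero    = 0≤ι 1
  expTerm-nonNeg 0≤a (suc i) = *-nonNeg (*-nonNeg (expTerm-nonNeg 0≤a i) 0≤a) (0≤1/[1+n] i)

  expTerm-mono-≤ : ∀ {a b} → 0ℚ ≤ a → a ≤ b → ∀ i → expTerm a i ≤ expTerm b i
  expTerm-mono-≤ 0≤a a≤b zero    = ≤-refl
  expTerm-mono-≤ {a} {b} 0≤a a≤b (suc i) = *-monoʳ-≤-nonNeg _ {{nonNegative (0≤1/[1+n] i)}} (begin
    expTerm a i * a ≤⟨ *-monoˡ-≤-0≤ (expTerm-nonNeg 0≤a i) a≤b ⟩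
    expTerm a i * b ≤⟨ *-monoʳ-≤-nonNeg b {{nonNegative (≤-trans 0≤a a≤b)}} (expTerm-mono-≤ 0≤a a≤b i) ⟩
    expTerm b i * b ∎)
    where open ≤-Reasoning

  expTerm-ratio : ∀ a i → ι (suc i) * expTerm a (suc i) ≡ a * expTerm a i
  expTerm-ratio a i = begin
    ι (suc i) * (expTerm a i * a * (ℤ.+ 1 / suc i)) ≡⟨ rearrange (ι (suc i)) (expTerm a i) a (ℤ.+ 1 / suc i) ⟩
    a * expTerm a i * (ι (suc i) * (ℤ.+ 1 / suc i)) ≡⟨ cong (a * expTerm a i *_) (ι[1+k]*[c/1+k]≡ι[c] i 1) ⟩
    a * expTerm a i * 1ℚ                           ≡⟨ *-identityʳ _ ⟩
    a * expTerm a i                                ∎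
    where
    open ≡-Reasoning
    rearrange : ∀ k t a v → k * (t * a * v) ≡ a * t * (k * v)
    rearrange = solve-∀ ℚ-ring

  -- multichoose m i = C(m+i−1, i), the coefficient of hⁱ in (1 − h)^(−m).
  multichoose : ℕ → ℕ → ℕ
  multichoose _       zero    = 1
  multichoose zero    (suc _) = 0
  multichoose (suc m) (suc i) = multichoose m (suc i) ℕ.+ multichoose (suc m) i

  multichoose-1 : ∀ m → multichoose m 1 ≡ m
  multichoose-1 zero    = refl
  multichoose-1 (suc m) = trans (cong (ℕ._+ 1) (multichoose-1 m)) (ℕ.+-comm m 1)

  multichoose-ratio : ∀ m i → suc i ℕ.* multichoose m (suc i) ≡ (m ℕ.+ i) ℕ.* multichoose m i
  multichoose-ratio zero    zero    = refl
  multichoose-ratio zero    (suc i) = trans (ℕ.*-zeroʳ (suc (suc i))) (sym (ℕ.*-zeroʳ (suc i)))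
  multichoose-ratio (suc m) zero    = trans (cong (λ x → 1 ℕ.* (x ℕ.+ 1)) (multichoose-1 m)) (reorder m)
    where
    reorder : ∀ m → 1 ℕ.* (m ℕ.+ 1) ≡ ((1 ℕ.+ m) ℕ.+ 0) ℕ.* 1
    reorder = ℕ-Solver.solve-∀
  multichoose-ratio (suc m) (suc i) = begin
    suc (suc i) ℕ.* (a ℕ.+ c)                     ≡⟨ ℕ.*-distribˡ-+ (suc (suc i)) a c ⟩
    suc (suc i) ℕ.* a ℕ.+ (c ℕ.+ suc i ℕ.* c)     ≡⟨ cong₂ (λ x y → x ℕ.+ (c ℕ.+ y)) (multichoose-ratio m (suc i))
                                                                                   (multichoose-ratio (suc m) i) ⟩
    (m ℕ.+ suc i) ℕ.* b ℕ.+ ((b ℕ.+ d) ℕ.+ (suc m ℕ.+ i) ℕ.* d) ≡⟨ collect m i b d ⟩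
    (suc m ℕ.+ suc i) ℕ.* (b ℕ.+ d)               ∎
    where
    open ≡-Reasoning
    a b c d : ℕ
    a = multichoose m (suc (suc i))
    b = multichoose m (suc i)
    c = multichoose (suc m) (suc i)
    d = multichoose (suc m) i
    collect : ∀ m i b d → (m ℕ.+ (1 ℕ.+ i)) ℕ.* b ℕ.+ ((b ℕ.+ d) ℕ.+ ((1 ℕ.+ m) ℕ.+ i) ℕ.* d)
                          ≡ ((1 ℕ.+ m) ℕ.+ (1 ℕ.+ i)) ℕ.* (b ℕ.+ d)
    collect = ℕ-Solver.solve-∀

  negBinomialTerm : ℕ → ℕ → ℚ
  negBinomialTerm m i = ι (multichoose m i) * ½ ^ i

  negBinomialTerm-pascal : ∀ m i →
    negBinomialTerm (suc m) (suc i) ≡ negBinomialTerm m (suc i) + ½ * negBinomialTerm (suc m) i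
  negBinomialTerm-pascal m i =
    trans (cong (_* (½ * ½ ^ i)) (ι-homo-+ (multichoose m (suc i)) (multichoose (suc m) i)))
          (distrib (ι (multichoose m (suc i))) (ι (multichoose (suc m) i)) ½ (½ ^ i))
    where
    distrib : ∀ a d h x → (a + d) * (h * x) ≡ a * (h * x) + h * (d * x)
    distrib = solve-∀ ℚ-ring

  negBinomialTerm-ratio : ∀ m i → ι (suc i) * negBinomialTerm m (suc i) ≡ ½ * (ι m + ι i) * negBinomialTerm m i
  negBinomialTerm-ratio m i = begin
    ι (suc i) * (ι (multichoose m (suc i)) * (½ * ½ ^ i))
      ≡⟨ rearrange (ι (suc i)) (ι (multichoose m (suc i))) ½ (½ ^ i) ⟩
    ½ * (ι (suc i) * ι (multichoose m (suc i))) * ½ ^ i     ≡⟨ cong (λ z → ½ * z * ½ ^ i) ratio ⟩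
    ½ * ((ι m + ι i) * ι (multichoose m i)) * ½ ^ i
      ≡⟨ regroup ½ (ι m + ι i) (ι (multichoose m i)) (½ ^ i) ⟩
    ½ * (ι m + ι i) * (ι (multichoose m i) * ½ ^ i)         ∎
    where
    open ≡-Reasoning
    rearrange : ∀ k c h x → k * (c * (h * x)) ≡ h * (k * c) * x
    rearrange = solve-∀ ℚ-ring
    regroup : ∀ h s c x → h * (s * c) * x ≡ h * s * (c * x)
    regroup = solve-∀ ℚ-ring
    ratio : ι (suc i) * ι (multichoose m (suc i)) ≡ (ι m + ι i) * ι (multichoose m i)
    ratio = begin
      ι (suc i) * ι (multichoose m (suc i))  ≡⟨ ι-homo-* (suc i) (multichoose m (suc i)) ⟨
      ι (suc i ℕ.* multichoose m (suc i))    ≡⟨ cong ι (multichoose-ratio m i) ⟩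
      ι ((m ℕ.+ i) ℕ.* multichoose m i)      ≡⟨ ι-homo-* (m ℕ.+ i) (multichoose m i) ⟩
      ι (m ℕ.+ i) * ι (multichoose m i)      ≡⟨ cong (_* ι (multichoose m i)) (ι-homo-+ m i) ⟩
      (ι m + ι i) * ι (multichoose m i)      ∎

  negBinomial-partialSum≤2^ : ∀ m N → partialSum (negBinomialTerm m) N ≤ ι (2 ℕ.^ m)
  negBinomial-partialSum≤2^ m       zero    = ι-mono-≤ (ℕ.m^n>0 2 m)
  negBinomial-partialSum≤2^ zero    (suc N) = ≤-trans
    (≤-reflexive (trans (cong (partialSum (negBinomialTerm zero) N +_) (*-zeroˡ (½ ^ suc N))) (+-identityʳ _)))
    (negBinomial-partialSum≤2^ zero N)
  negBinomial-partialSum≤2^ (suc m) (suc N) = begin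
    partialSum (negBinomialTerm (suc m)) (suc N)
      ≡⟨ partialSum-shift ½ refl (negBinomialTerm-pascal m) N ⟩
    partialSum (negBinomialTerm m) (suc N) + ½ * partialSum (negBinomialTerm (suc m)) N
      ≤⟨ +-mono-≤ (negBinomial-partialSum≤2^ m (suc N))
                  (*-monoˡ-≤-0≤ 0≤½ (negBinomial-partialSum≤2^ (suc m) N)) ⟩
    ι (2 ℕ.^ m) + ½ * ι (2 ℕ.^ suc m)
      ≡⟨ cong (λ z → ι (2 ℕ.^ m) + ½ * z) (ι-homo-* 2 (2 ℕ.^ m)) ⟩
    ι (2 ℕ.^ m) + ½ * (ι 2 * ι (2 ℕ.^ m))
      ≡⟨ doubling (ι (2 ℕ.^ m)) ⟩
    ι 2 * ι (2 ℕ.^ m)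
      ≡⟨ ι-homo-* 2 (2 ℕ.^ m) ⟨
    ι (2 ℕ.^ suc m) ∎
    where
    open ≤-Reasoning
    doubling : ∀ x → x + ½ * (ι 2 * x) ≡ ι 2 * x
    doubling = solve-∀ ℚ-ring

  expTerm≤negBinomialTerm : ∀ r i → expTerm (ι r) i ≤ negBinomialTerm (2 ℕ.* r) i
  expTerm≤negBinomialTerm r zero    = ≤-refl
  expTerm≤negBinomialTerm r (suc i) = *-cancelˡ-≤-pos (ι (suc i)) {{positive (0<ι[1+n] i)}} (begin
    ι (suc i) * expTerm (ι r) (suc i)              ≡⟨ expTerm-ratio (ι r) i ⟩
    ι r * expTerm (ι r) i                          ≤⟨ *-monoˡ-≤-0≤ (0≤ι r) (expTerm≤negBinomialTerm r i) ⟩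
    ι r * negBinomialTerm m i                      ≤⟨ *-monoʳ-≤-nonNeg (negBinomialTerm m i)
                                                        {{nonNegative 0≤term}} r≤½[m+i] ⟩
    ½ * (ι m + ι i) * negBinomialTerm m i          ≡⟨ negBinomialTerm-ratio m i ⟨
    ι (suc i) * negBinomialTerm m (suc i)          ∎)
    where
    open ≤-Reasoning
    m : ℕ
    m = 2 ℕ.* r
    ½^-nonNeg : ∀ i → 0ℚ ≤ ½ ^ i
    ½^-nonNeg zero    = 0≤ι 1
    ½^-nonNeg (suc i) = *-nonNeg 0≤½ (½^-nonNeg i)
    0≤term : 0ℚ ≤ negBinomialTerm m i
    0≤term = *-nonNeg (0≤ι (multichoose m i)) (½^-nonNeg i)
    halving : ∀ x → ½ * (ι 2 * x) ≡ x
    halving = solve-∀ ℚ-ring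
    r≤½[m+i] : ι r ≤ ½ * (ι m + ι i)
    r≤½[m+i] = begin
      ι r               ≡⟨ trans (cong (½ *_) (ι-homo-* 2 r)) (halving (ι r)) ⟨
      ½ * ι m           ≤⟨ *-monoˡ-≤-0≤ 0≤½ (subst (_≤ ι m + ι i) (+-identityʳ (ι m))
                                                              (+-monoʳ-≤ (ι m) (0≤ι i))) ⟩
      ½ * (ι m + ι i)   ∎

  ≤rank⇒≤2rank·log[2+k] : ∀ {a} r k → 0ℚ ≤ a → a ≤ ι r → a ≤ (2 ℕ.* r) ·log (suc (suc k))
  ≤rank⇒≤2rank·log[2+k] {a} r k 0≤a a≤r = inj₂ λ N → begin
    expPartial a N                               ≡⟨ expPartial≡partialSum a N ⟩
    partialSum (expTerm a) N                     ≤⟨ partialSum-mono-≤ (expTerm-mono-≤ 0≤a a≤r) N ⟩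
    partialSum (expTerm (ι r)) N                 ≤⟨ partialSum-mono-≤ (expTerm≤negBinomialTerm r) N ⟩
    partialSum (negBinomialTerm (2 ℕ.* r)) N     ≤⟨ negBinomial-partialSum≤2^ (2 ℕ.* r) N ⟩
    ι (2 ℕ.^ (2 ℕ.* r))                          ≤⟨ ι-mono-≤ (ℕ.^-monoˡ-≤ (2 ℕ.* r) (s≤s (s≤s z≤n))) ⟩
    ι (suc (suc k) ℕ.^ (2 ℕ.* r))                ∎
    where open ≤-Reasoning

open import Defs
open import Data.Nat using (ℕ; suc; _≤_; _*_)
open import Data.Integer using (+_)
open import Data.Rational using (ℚ; _/_; _-_)
import Data.Rational as Q
open import Data.Fin using (Fin)
open import Data.Fin.Subset using (Subset)
open GreedyBasePacking using (scaledError-nonNeg; scaledError≤rank; ≤rank⇒≤2rank·log[2+k])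

corollary4 : ∀ {n} (M : Matroid n) (r : ℕ) → HasRank M r → 1 ≤ r →
    (x* : Fin n → ℚ) → IsMinNormPoint M x* →
    (B : ℕ → Subset n) → IsGreedyBasePacking M B →
    ∀ k → 1 ≤ k →
    (((+ k) / 1) Q.* normSq (λ e → load B k e - x* e)) ≤ (2 * r) ·log (suc k)
corollary4 M r rank _ x* x*-min B greedy (suc k) _ =
  ≤rank⇒≤2rank·log[2+k] r k (scaledError-nonNeg M rank x*-min greedy (suc k))
                             (scaledError≤rank M rank x*-min greedy k)
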